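{- For $n\geq 2$, $|\hat{\mathcal{B}}_n(221)|=n-1$.
   Context: An endofunction of size $n$ is a word $x=x_1\cdots x_n$ with entries in $\{1,\dots,n\}$; it is a Cayley permutation if it contains every integer between $1$ and $\max(x)$. Let $\mathrm{Ascbot}(x)=\{1\}\cup\{i:1\leq i\leq n-1,\ x_i<x_{i+1}\}$ and $\mathrm{Nub}(x)$ the set of indices $i$ such that $x_i$ is the leftmost occurrence of its value. A revised ascent sequence of length $n$ is a Cayley permutation $x$ of length $n$ with $\mathrm{Ascbot}(x)=\mathrm{Nub}(x)$. For Cayley permutations $x$ and $\sigma=\sigma_1\cdots\sigma_k$, $x$ contains $\sigma$ if there are indices $i_1<\cdots<i_k$ such that for all $s,t$: $x_{i_s}<x_{i_t}\iff\sigma_s<\sigma_t$ and $x_{i_s}=x_{i_t}\iff\sigma_s=\sigma_t$; otherwise $x$ avoids $\sigma$. $\hat{\mathcal{B}}_n(\sigma)$ is the set of revised ascent sequences of length $n$ avoiding $\sigma$. -}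

module Defs where

open import Data.Bool using (Bool; true; false; _∧_; _∨_; not; if_then_else_)
open import Data.Nat using (ℕ; zero; suc; _+_; _∸_; _<ᵇ_; _≡ᵇ_; _⊔_)
open import Data.List using (List; []; _∷_; length; map; concatMap; filterᵇ; foldr; applyUpTo)
open import Data.Bool.ListAction using (all; any)

-- Words are lists of naturals; positions are 1-based as in the paper.

range1 : ℕ → List ℕ
range1 m = applyUpTo suc m

words : ℕ → ℕ → List (List ℕ)
words zero    m = [] ∷ []
words (suc k) m = concatMap (λ a → map (a ∷_) (words k m)) (range1 m)

endofunctions : ℕ → List (List ℕ)
endofunctions n = words n n

-- x_i (1-based); value 0 outside the valid range (never used there).
at : List ℕ → ℕ → ℕ
at []      _             = 0
at (a ∷ _) zero          = 0
at (a ∷ _) (suc zero)    = a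
at (_ ∷ xs) (suc (suc i)) = at xs (suc i)

maxW : List ℕ → ℕ
maxW = foldr _⊔_ 0

elemᵇ : ℕ → List ℕ → Bool
elemᵇ v xs = any (λ y → v ≡ᵇ y) xs

_⇔ᵇ_ : Bool → Bool → Bool
a ⇔ᵇ b = if a then b else not b

isCayley : List ℕ → Bool
isCayley x = all (λ v → elemᵇ v x) (range1 (maxW x))

inAscbot : List ℕ → ℕ → Bool
inAscbot x i = (i ≡ᵇ 1) ∨ ((0 <ᵇ i) ∧ (i <ᵇ length x) ∧ (at x i <ᵇ at x (suc i)))

inNub : List ℕ → ℕ → Bool
inNub x i = (0 <ᵇ i) ∧ (i <ᵇ suc (length x))
            ∧ all (λ j → not (at x j ≡ᵇ at x i)) (range1 (i ∸ 1))

-- Ascbot(x) = Nub(x) as subsets of ℕ.  Both are subsets of {1,...,max(1,n)},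
-- so it suffices to compare membership on {1,...,n+1}.
ascbotEqNub : List ℕ → Bool
ascbotEqNub x = all (λ i → inAscbot x i ⇔ᵇ inNub x i) (range1 (suc (length x)))

isRAS : List ℕ → Bool
isRAS x = isCayley x ∧ ascbotEqNub x

choose : ℕ → List ℕ → List (List ℕ)
choose zero    _        = [] ∷ []
choose (suc k) []       = []
choose (suc k) (a ∷ as) = map (a ∷_) (choose k as) ++' choose (suc k) as
  where
  _++'_ : List (List ℕ) → List (List ℕ) → List (List ℕ)
  []       ++' ys = ys
  (z ∷ zs) ++' ys = z ∷ (zs ++' ys)

isoAt : List ℕ → List ℕ → List ℕ → Bool
isoAt x σ is =
  all (λ s → all (λ t →
        ((at x (at is s) <ᵇ at x (at is t)) ⇔ᵇ (at σ s <ᵇ at σ t))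
      ∧ ((at x (at is s) ≡ᵇ at x (at is t)) ⇔ᵇ (at σ s ≡ᵇ at σ t)))
      (range1 (length σ))) (range1 (length σ))

contains : List ℕ → List ℕ → Bool
contains x σ = any (isoAt x σ) (choose (length σ) (range1 (length x)))

avoids : List ℕ → List ℕ → Bool
avoids x σ = not (contains x σ)

RASavoiding : ℕ → List ℕ → List (List ℕ)
RASavoiding n σ = filterᵇ (λ x → isRAS x ∧ avoids x σ) (endofunctions n)

module Submission where

-- Let x be a revised ascent sequence of length n ≥ 2 avoiding 221, with x₁ = k, and let j be the
-- first position whose entry repeats an earlier one (position n is a repeat, as it is never an
-- ascent bottom). The entries at 2, …, j − 1 are new, hence ascent bottoms, so x₂ < ⋯ < x_j, and
-- x_j can only repeat x₁. From j on every entry equals k: it cannot ascend, and dropping below k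
-- would complete a 221 with x₁ and x_j. As x is Cayley, x₂, …, x_{j−1} take every value below k, so
-- they are 1, 2, …, k − 1 and x is the staircase k 1 2 ⋯ (k−1) k ⋯ k with 1 ≤ k ≤ n − 1. Conversely
-- every such staircase qualifies; the filtered list of words and the list of staircases are
-- duplicate-free with the same members, hence permutations of each other.

open import Defs
open import Data.Bool using (Bool; true; false; T; not; _∧_)
open import Data.Bool.Properties using (T-∧; T-≡; T-not-≡)
open import Data.Bool.ListAction using (all; any)
open import Data.List using (List; []; _∷_; length; map; applyUpTo; cartesianProductWith; concatMap; _++_)
open import Data.List.Properties using (∷-injective; length-map; length-applyUpTo)
open import Data.List.Membership.Propositional using (_∈_; find)
open import Data.List.Membership.Propositional.Properties
  using ( ∈-applyUpTo⁺; ∈-applyUpTo⁻; ∈-map⁺; ∈-map⁻; ∈-filter⁺; ∈-filter⁻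
        ; ∈-++⁻; ∈-++⁺ˡ; ∈-++⁺ʳ; ∈-cartesianProductWith⁺; ∈-cartesianProductWith⁻)
open import Data.List.Membership.Propositional.Properties.WithK using (unique∧set⇒bag)
open import Data.List.Relation.Unary.All as All using (All; []; _∷_)
import Data.List.Relation.Unary.All.Properties as Allₚ
open import Data.List.Relation.Unary.Any as Any using (here; there)
open import Data.List.Relation.Unary.Any.Properties using (any⇔)
open import Data.List.Relation.Unary.AllPairs using (AllPairs; []; _∷_)
import Data.List.Relation.Unary.AllPairs.Properties as AllPairsₚ
open import Data.List.Relation.Unary.Unique.Propositional using (Unique)
import Data.List.Relation.Unary.Unique.Propositional.Properties as Uniqueₚ
open import Data.List.Relation.Binary.Sublist.Propositional using (_⊆_; []; _∷_; _∷ʳ_; minimum; lookup)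
open import Data.List.Relation.Binary.Sublist.Propositional.Properties using (All-resp-⊆)
open import Data.List.Relation.Binary.BagAndSetEquality using (∼bag⇒↭)
open import Data.List.Relation.Binary.Permutation.Propositional using (_↭_)
open import Data.List.Relation.Binary.Permutation.Propositional.Properties using (↭-length)
open import Data.Nat
open import Data.Nat.Properties
open import Data.Nat.Induction using (<-rec)
open import Data.Product using (∃; _×_; _,_; proj₁; proj₂)
open import Data.Sum using (inj₁; inj₂)
open import Function using (_⇔_; mk⇔; Equivalence; _∘_)
open import Function.Properties.Equivalence using () renaming (sym to ⇔-sym; trans to ⇔-trans)
open import Relation.Binary.Definitions using (tri<; tri≈; tri>)
open import Relation.Binary.PropositionalEquality
open import Relation.Nullary using (¬_; Dec; yes; no; contradiction)
open import Relation.Nullary.Decidable using (T?)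
open import Relation.Unary using (Decidable)

open Equivalence using (to; from)

-- Reflecting the boolean definitions

T-not : ∀ {b} → T (not b) ⇔ (¬ T b)
T-not {true}  = mk⇔ (λ ()) (λ ¬t → ¬t _)
T-not {false} = mk⇔ (λ _ ()) _

T-⇔ᵇ : ∀ {a b} → T (a ⇔ᵇ b) ⇔ (T a ⇔ T b)
T-⇔ᵇ {true}  {true}  = mk⇔ (λ _ → mk⇔ _ _) _
T-⇔ᵇ {true}  {false} = mk⇔ (λ ()) (λ t⇔f → to t⇔f _)
T-⇔ᵇ {false} {true}  = mk⇔ (λ ()) (λ f⇔t → from f⇔t _)
T-⇔ᵇ {false} {false} = mk⇔ (λ _ → mk⇔ (λ ()) (λ ())) _

T-all-range1 : ∀ (p : ℕ → Bool) m → T (all p (range1 m)) ⇔ (∀ {q} → q < m → T (p (suc q)))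
T-all-range1 p m = mk⇔ (Allₚ.applyUpTo⁻ suc m ∘ Allₚ.all⁺ p _) (Allₚ.all⁻ p ∘ Allₚ.applyUpTo⁺₁ suc m)

T-elemᵇ : ∀ {v} x → T (elemᵇ v x) ⇔ v ∈ x
T-elemᵇ {v} x = mk⇔ (Any.map (≡ᵇ⇒≡ v _) ∘ from any⇔) (to any⇔ ∘ Any.map (≡⇒≡ᵇ v _))

∈-range1 : ∀ {v m} → v ∈ range1 m ⇔ (1 ≤ v × v ≤ m)
∈-range1 {v} {m} = mk⇔ bounds member
  where
  bounds : v ∈ range1 m → 1 ≤ v × v ≤ m
  bounds v∈ with ∈-applyUpTo⁻ suc v∈
  ... | _ , q<m , refl = s≤s z≤n , q<m
  member : 1 ≤ v × v ≤ m → v ∈ range1 m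
  member (s≤s _ , v≤m) = ∈-applyUpTo⁺ suc v≤m

at-applyUpTo : ∀ (f : ℕ → ℕ) {m q} → q < m → at (applyUpTo f m) (suc q) ≡ f q
at-applyUpTo f {suc m} {zero}  _         = refl
at-applyUpTo f {suc m} {suc q} (s≤s q<m) = at-applyUpTo (f ∘ suc) q<m

applyUpTo-ext : ∀ (f : ℕ → ℕ) y → (∀ {q} → q < length y → at y (suc q) ≡ f q) → y ≡ applyUpTo f (length y)
applyUpTo-ext f []      _  = refl
applyUpTo-ext f (a ∷ y) eq = cong₂ _∷_ (eq z<s) (applyUpTo-ext (f ∘ suc) y (eq ∘ s<s))

∈⇒at : ∀ {v} x → v ∈ x → ∃ λ q → q < length x × at x (suc q) ≡ v
∈⇒at (a ∷ x) (here refl) = 0 , z<s , refl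
∈⇒at (a ∷ x) (there v∈x) with ∈⇒at x v∈x
... | q , q<n , eq = suc q , s<s q<n , eq

All-at : ∀ {P : ℕ → Set} {x} → All P x → ∀ {q} → q < length x → P (at x (suc q))
All-at (px ∷ _)   {zero}  _         = px
All-at (_  ∷ pxs) {suc q} (s≤s q<n) = All-at pxs q<n

maxW-least : ∀ {b} x → All (_≤ b) x → maxW x ≤ b
maxW-least []      []          = z≤n
maxW-least (a ∷ x) (a≤b ∷ x≤b) = ⊔-lub a≤b (maxW-least x x≤b)

Repeated : List ℕ → ℕ → Set
Repeated x i = ∃ λ q → q < i ∸ 1 × at x (suc q) ≡ at x i

repeated? : ∀ x i → Dec (Repeated x i)
repeated? x i = anyUpTo? (λ q → at x (suc q) ≟ at x i) (i ∸ 1)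

T-inNub : ∀ x {i} → 1 ≤ i → i ≤ length x → T (inNub x i) ⇔ (¬ Repeated x i)
T-inNub x {suc i} _ i<n = mk⇔ (fresh⁻ ∘ proj₂ ∘ to T-∧) (λ ¬rep → from T-∧ (<⇒<ᵇ i<n , fresh⁺ ¬rep))
  where
  fresh⁻ : T (all (λ j → not (at x j ≡ᵇ at x (suc i))) (range1 i)) → ¬ Repeated x (suc i)
  fresh⁻ t (q , q<i , eq) = to T-not (to (T-all-range1 _ i) t q<i) (≡⇒≡ᵇ _ _ eq)
  fresh⁺ : ¬ Repeated x (suc i) → T (all (λ j → not (at x j ≡ᵇ at x (suc i))) (range1 i))
  fresh⁺ ¬rep = from (T-all-range1 _ i) (λ q<i → from T-not (λ t → ¬rep (_ , q<i , ≡ᵇ⇒≡ _ _ t)))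

inNub-beyond : ∀ x {i} → length x < i → ¬ T (inNub x i)
inNub-beyond x {suc i} (s≤s n≤i) t = <⇒≱ (<ᵇ⇒< _ _ (proj₁ (to T-∧ t))) n≤i

T-inAscbot : ∀ x {i} → 2 ≤ i → i < length x → T (inAscbot x i) ⇔ (at x i < at x (suc i))
T-inAscbot x (s≤s (s≤s z≤n)) i<n =
  mk⇔ (<ᵇ⇒< _ _ ∘ proj₂ ∘ to T-∧) (λ asc → from T-∧ (<⇒<ᵇ i<n , <⇒<ᵇ asc))

inAscbot-last : ∀ x {i} → 2 ≤ i → length x ≤ i → ¬ T (inAscbot x i)
inAscbot-last x (s≤s (s≤s z≤n)) n≤i t = <⇒≱ (<ᵇ⇒< _ _ (proj₁ (to T-∧ t))) n≤i

AscentsAreNew : List ℕ → Set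
AscentsAreNew x = ∀ {i} → 2 ≤ i → i < length x → at x i < at x (suc i) ⇔ (¬ Repeated x i)

module _ (x : List ℕ) (2≤n : 2 ≤ length x) where

  private
    1≤n : 1 ≤ length x
    1≤n = ≤-trans (s≤s z≤n) 2≤n

    Ascbot⇔Nub : Set
    Ascbot⇔Nub = ∀ {i} → 1 ≤ i → i ≤ suc (length x) → T (inAscbot x i) ⇔ T (inNub x i)

    T-ascbotEqNub′ : T (ascbotEqNub x) ⇔ Ascbot⇔Nub
    T-ascbotEqNub′ = mk⇔ pointwise (λ eq → from (T-all-range1 _ _) (λ q<n → from T-⇔ᵇ (eq (s≤s z≤n) q<n)))
      where
      pointwise : T (ascbotEqNub x) → Ascbot⇔Nub
      pointwise t {suc i} _ i≤n = to T-⇔ᵇ (to (T-all-range1 _ _) t i≤n)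

    ascentsAreNew : Ascbot⇔Nub → AscentsAreNew x
    ascentsAreNew eq 2≤i i<n =
      ⇔-trans (⇔-sym (T-inAscbot x 2≤i i<n))
              (⇔-trans (eq 1≤i (m≤n⇒m≤1+n (<⇒≤ i<n))) (T-inNub x 1≤i (<⇒≤ i<n)))
      where 1≤i = ≤-trans (s≤s z≤n) 2≤i

    lastRepeated : Ascbot⇔Nub → Repeated x (length x)
    lastRepeated eq with repeated? x (length x)
    ... | yes rep  = rep
    ... | no  ¬rep =
      contradiction (from (eq 1≤n (n≤1+n _)) (from (T-inNub x 1≤n ≤-refl) ¬rep)) (inAscbot-last x 2≤n ≤-refl)

    ascbot⇔nub : AscentsAreNew x → Repeated x (length x) → Ascbot⇔Nub
    ascbot⇔nub _ _ {suc zero} _ _ = mk⇔ (λ _ → from (T-inNub x ≤-refl 1≤n) λ ()) _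
    ascbot⇔nub new last {i@(suc (suc _))} _ _ with <-cmp i (length x)
    ... | tri< i<n _ _ =
      ⇔-trans (T-inAscbot x (s≤s (s≤s z≤n)) i<n)
              (⇔-trans (new (s≤s (s≤s z≤n)) i<n) (⇔-sym (T-inNub x (s≤s z≤n) (<⇒≤ i<n))))
    ... | tri≈ _ i≡n _ = mk⇔
      (λ asc → contradiction asc (inAscbot-last x (s≤s (s≤s z≤n)) (≤-reflexive (sym i≡n))))
      (λ nub → contradiction (subst (Repeated x) (sym i≡n) last) (to (T-inNub x (s≤s z≤n) (≤-reflexive i≡n)) nub))
    ... | tri> _ _ n<i = mk⇔
      (λ asc → contradiction asc (inAscbot-last x (s≤s (s≤s z≤n)) (<⇒≤ n<i)))
      (λ nub → contradiction nub (inNub-beyond x n<i))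

  T-ascbotEqNub : T (ascbotEqNub x) ⇔ (AscentsAreNew x × Repeated x (length x))
  T-ascbotEqNub = mk⇔ unpack pack
    where
    unpack : T (ascbotEqNub x) → AscentsAreNew x × Repeated x (length x)
    unpack t = ascentsAreNew (to T-ascbotEqNub′ t) , lastRepeated (to T-ascbotEqNub′ t)
    pack : AscentsAreNew x × Repeated x (length x) → T (ascbotEqNub x)
    pack (new , last) = from T-ascbotEqNub′ (λ {i} → ascbot⇔nub new last {i})

T-isCayley : ∀ x → T (isCayley x) ⇔ (∀ {v} → 1 ≤ v → v ≤ maxW x → v ∈ x)
T-isCayley x = mk⇔
  (λ t → λ { {suc v} _ v≤max → to (T-elemᵇ x) (to (T-all-range1 _ _) t v≤max) })
  (λ cayley → from (T-all-range1 _ _) (λ v<max → from (T-elemᵇ x) (cayley (s≤s z≤n) v<max)))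

-- For n ≥ 2, Ascbot(x) = Nub(x) amounts to ascentsAreNew (positions 2 ≤ i < n) and lastRepeated
-- (position n is never an ascent bottom).
record IsRAS (x : List ℕ) : Set where
  field
    cayley        : ∀ {v} → 1 ≤ v → v ≤ maxW x → v ∈ x
    ascentsAreNew : AscentsAreNew x
    lastRepeated  : Repeated x (length x)

T-isRAS : ∀ x → 2 ≤ length x → T (isRAS x) ⇔ IsRAS x
T-isRAS x 2≤n = mk⇔ unpack pack
  where
  unpack : T (isRAS x) → IsRAS x
  unpack t with to T-∧ t
  ... | cay , asc = record
    { cayley        = to (T-isCayley x) cay
    ; ascentsAreNew = proj₁ (to (T-ascbotEqNub x 2≤n) asc)
    ; lastRepeated  = proj₂ (to (T-ascbotEqNub x 2≤n) asc)
    }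
  pack : IsRAS x → T (isRAS x)
  pack ras = from T-∧ (from (T-isCayley x) cayley , from (T-ascbotEqNub x 2≤n) (ascentsAreNew , lastRepeated))
    where open IsRAS ras

++-unique : ∀ {A : Set} {f : List A → List A} → (∀ z zs → f (z ∷ zs) ≡ z ∷ f zs) → ∀ zs → f zs ≡ zs ++ f []
++-unique f-∷ []       = refl
++-unique f-∷ (z ∷ zs) = trans (f-∷ z zs) (cong (z ∷_) (++-unique f-∷ zs))

-- choose concatenates with a local copy of _++_, which ++-unique identifies with _++_.
choose-∷ : ∀ k a as → choose (suc k) (a ∷ as) ≡ map (a ∷_) (choose k as) ++ choose (suc k) as
choose-∷ k a as with ++-unique (λ _ _ → refl) | map {B = List ℕ} (a ∷_) (choose k as)
... | ++-spec | zs = ++-spec zs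

∈-choose⁻ : ∀ k L {is} → is ∈ choose k L → length is ≡ k × is ⊆ L
∈-choose⁻ zero    L        (here refl) = refl , minimum L
∈-choose⁻ (suc k) (a ∷ L)  is∈ with ∈-++⁻ (map (a ∷_) (choose k L)) (subst (_ ∈_) (choose-∷ k a L) is∈)
... | inj₁ is∈map with ∈-map⁻ (a ∷_) is∈map
...   | is , is∈ , refl = let len , sub = ∈-choose⁻ k L is∈ in cong suc len , refl ∷ sub
∈-choose⁻ (suc k) (a ∷ L)  _ | inj₂ is∈ = let len , sub = ∈-choose⁻ (suc k) L is∈ in len , a ∷ʳ sub

∈-choose⁺ : ∀ {is L} → is ⊆ L → is ∈ choose (length is) L
∈-choose⁺ {[]}     _ = here refl
∈-choose⁺ {i ∷ is} {a ∷ L} (_ ∷ʳ sub) =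
  subst ((i ∷ is) ∈_) (sym (choose-∷ (length is) a L))
        (∈-++⁺ʳ (map {B = List ℕ} (a ∷_) (choose (length is) L)) (∈-choose⁺ sub))
∈-choose⁺ {i ∷ is} {_ ∷ L} (refl ∷ sub) =
  subst ((i ∷ is) ∈_) (sym (choose-∷ (length is) i L)) (∈-++⁺ˡ (∈-map⁺ (i ∷_) (∈-choose⁺ sub)))

AllPairs-resp-⊆ : ∀ {R : ℕ → ℕ → Set} {xs ys} → xs ⊆ ys → AllPairs R ys → AllPairs R xs
AllPairs-resp-⊆ []           []         = []
AllPairs-resp-⊆ (_ ∷ʳ sub)   (_ ∷ rys)  = AllPairs-resp-⊆ sub rys
AllPairs-resp-⊆ (refl ∷ sub) (ry ∷ rys) = All-resp-⊆ sub ry ∷ AllPairs-resp-⊆ sub rys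

increasing-⊆ : ∀ {xs ys} → AllPairs _<_ xs → AllPairs _<_ ys → All (_∈ ys) xs → xs ⊆ ys
increasing-⊆ {[]}     _ _ _ = minimum _
increasing-⊆ {x ∷ xs} {y ∷ ys} (x<xs ∷ xs↑) (_ ∷ ys↑) (here refl ∷ xs∈) =
  refl ∷ increasing-⊆ xs↑ ys↑ (All.zipWith (λ (x<z , z∈) → Any.tail (<⇒≢ x<z ∘ sym) z∈) (x<xs , xs∈))
increasing-⊆ {x ∷ xs} {y ∷ ys} (x<xs ∷ xs↑) (y<ys ∷ ys↑) (there x∈ys ∷ xs∈) =
  y ∷ʳ increasing-⊆ (x<xs ∷ xs↑) ys↑ (x∈ys ∷ All.zipWith drop-y (x<xs , xs∈))
  where
  drop-y : ∀ {z} → x < z × z ∈ y ∷ ys → z ∈ ys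
  drop-y (x<z , z∈) = Any.tail (<⇒≢ (<-trans (All.lookup y<ys x∈ys) x<z) ∘ sym) z∈

range1-increasing : ∀ m → AllPairs _<_ (range1 m)
range1-increasing m = AllPairsₚ.applyUpTo⁺₁ suc m (λ i<j _ → s≤s i<j)

triple-⊆-range1 : ∀ {i j l n} → (i ∷ j ∷ l ∷ []) ⊆ range1 n ⇔ (1 ≤ i × i < j × j < l × l ≤ n)
triple-⊆-range1 {i} {j} {l} {n} = mk⇔ bounds sublist
  where
  bounds : (i ∷ j ∷ l ∷ []) ⊆ range1 n → 1 ≤ i × i < j × j < l × l ≤ n
  bounds sub with AllPairs-resp-⊆ sub (range1-increasing n)
  ... | (i<j ∷ _) ∷ (j<l ∷ []) ∷ [] ∷ [] =
    proj₁ (to ∈-range1 (lookup sub (here refl))) , i<j , j<l ,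
    proj₂ (to ∈-range1 (lookup sub (there (there (here refl)))))
  member : ∀ {v} → 1 ≤ v × v ≤ n → v ∈ range1 n
  member = from ∈-range1
  sublist : 1 ≤ i × i < j × j < l × l ≤ n → (i ∷ j ∷ l ∷ []) ⊆ range1 n
  sublist (1≤i , i<j , j<l , l≤n) = increasing-⊆
    ((i<j ∷ i<l ∷ []) ∷ (j<l ∷ []) ∷ [] ∷ [])
    (range1-increasing n)
    ( member (1≤i , <⇒≤ (<-≤-trans i<l l≤n))
    ∷ member (≤-trans 1≤i (<⇒≤ i<j) , <⇒≤ (<-≤-trans j<l l≤n))
    ∷ member (≤-trans 1≤i (<⇒≤ i<l) , l≤n)
    ∷ [])
    where i<l = <-trans i<j j<l

σ221 : List ℕ
σ221 = 2 ∷ 2 ∷ 1 ∷ []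

module _ (x : List ℕ) {i j l : ℕ} where

  private
    -- The entries of the comparison table of isoAt, named so that T-all-range1 need not infer them.
    cell : ℕ → ℕ → Bool
    cell s t = ((at x (at is s) <ᵇ at x (at is t)) ⇔ᵇ (at σ221 s <ᵇ at σ221 t))
             ∧ ((at x (at is s) ≡ᵇ at x (at is t)) ⇔ᵇ (at σ221 s ≡ᵇ at σ221 t))
      where is = i ∷ j ∷ l ∷ []

    T-cell : T (isoAt x σ221 (i ∷ j ∷ l ∷ [])) → ∀ {s t} → s < 3 → t < 3 → T (cell (suc s) (suc t))
    T-cell iso {s} s<3 =
      to (T-all-range1 (cell (suc s)) 3) (to (T-all-range1 (λ s → all (cell s) (range1 3)) 3) iso s<3)

  iso221⁻ : T (isoAt x σ221 (i ∷ j ∷ l ∷ [])) → at x i ≡ at x j × at x l < at x i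
  iso221⁻ iso = ≡ᵇ⇒≡ _ _ (from (to T-⇔ᵇ (proj₂ (to T-∧ (T-cell iso z<s (s≤s z<s))))) _)
              , <ᵇ⇒< _ _ (from (to T-⇔ᵇ (proj₁ (to T-∧ (T-cell iso (s≤s (s≤s z<s)) z<s)))) _)

iso221⁺ : ∀ x {i j l} → at x i ≡ at x j → at x l < at x i → T (isoAt x σ221 (i ∷ j ∷ l ∷ []))
iso221⁺ x {i} {j} {l} xᵢ≡xⱼ xₗ<xᵢ with at x i | at x j | at x l | xᵢ≡xⱼ | xₗ<xᵢ
... | a | .a | c | refl | c<a
  rewrite to T-≡ (≡⇒≡ᵇ a a refl) | to T-≡ (≡⇒≡ᵇ c c refl) | to T-≡ (<⇒<ᵇ c<a)
        | to T-not-≡ (from T-not (n≮n a ∘ <ᵇ⇒< a a)) | to T-not-≡ (from T-not (n≮n c ∘ <ᵇ⇒< c c))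
        | to T-not-≡ (from T-not (<-asym c<a ∘ <ᵇ⇒< a c))
        | to T-not-≡ (from T-not (<⇒≢ c<a ∘ sym ∘ ≡ᵇ⇒≡ a c))
        | to T-not-≡ (from T-not (<⇒≢ c<a ∘ ≡ᵇ⇒≡ c a)) = _

record Occurrence221 (x : List ℕ) : Set where
  constructor occurrence
  field
    {i j l}   : ℕ
    positions : 1 ≤ i × i < j × j < l × l ≤ length x
    xᵢ≡xⱼ     : at x i ≡ at x j
    xₗ<xᵢ     : at x l < at x i

T-contains221 : ∀ x → T (contains x σ221) ⇔ Occurrence221 x
T-contains221 x = mk⇔ unpack pack
  where
  fromTriple : ∀ is → length is ≡ 3 → is ⊆ range1 (length x) → T (isoAt x σ221 is) → Occurrence221 x
  fromTriple (i ∷ j ∷ l ∷ []) refl sub iso =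
    let eq , lt = iso221⁻ x iso in occurrence (to triple-⊆-range1 sub) eq lt
  unpack : T (contains x σ221) → Occurrence221 x
  unpack t with find (from any⇔ t)
  ... | is , is∈ , iso = let len , sub = ∈-choose⁻ 3 _ is∈ in fromTriple is len sub iso
  pack : Occurrence221 x → T (contains x σ221)
  pack (occurrence ps eq lt) =
    to any⇔ (Any.map (λ { refl → iso221⁺ x eq lt }) (∈-choose⁺ (from triple-⊆-range1 ps)))

-- Strictly increasing sequences

module StrictlyIncreasing (f : ℕ → ℕ) (m : ℕ) (ascent : ∀ {q} → q < m → f q < f (suc q)) where

  increasing : ∀ {p q} → p < q → q ≤ m → f p < f q
  increasing {p} {suc q} (s≤s p≤q) q<m with m≤n⇒m<n∨m≡n p≤q
  ... | inj₁ p<q  = <-trans (increasing p<q (<⇒≤ q<m)) (ascent q<m)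
  ... | inj₂ refl = ascent q<m

  monotone : ∀ {p q} → p ≤ q → q ≤ m → f p ≤ f q
  monotone p≤q q≤m with m≤n⇒m<n∨m≡n p≤q
  ... | inj₁ p<q  = <⇒≤ (increasing p<q q≤m)
  ... | inj₂ refl = ≤-refl

  module _ {c : ℕ} (c≤f₀ : c ≤ f 0) (onto : ∀ {v} → c ≤ v → v < f m → ∃ λ p → p < m × f p ≡ v) where

    private
      f₀≡c : f 0 ≡ c
      f₀≡c = ≤-antisym (≮⇒≥ skipped) c≤f₀
        where
        skipped : ¬ c < f 0
        skipped c<f₀ with onto ≤-refl (<-≤-trans c<f₀ (monotone z≤n ≤-refl))
        ... | p , p<m , refl = <⇒≱ c<f₀ (monotone z≤n (<⇒≤ p<m))

      step : ∀ {q} → q < m → f (suc q) ≡ suc (f q)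
      step {q} q<m = ≤-antisym (≮⇒≥ skipped) (ascent q<m)
        where
        c≤fq+1 = ≤-trans c≤f₀ (≤-trans (monotone z≤n (<⇒≤ q<m)) (n≤1+n _))
        skipped : ¬ suc (f q) < f (suc q)
        skipped gap with onto c≤fq+1 (<-≤-trans gap (monotone q<m ≤-refl))
        ... | p , p<m , fₚ≡ with p ≤? q
        ...   | yes p≤q = 1+n≰n (subst (_≤ f q) fₚ≡ (monotone p≤q (<⇒≤ q<m)))
        ...   | no  p≰q = <⇒≱ gap (≤-trans (monotone (≰⇒> p≰q) (<⇒≤ p<m)) (≤-reflexive fₚ≡))

    consecutive : ∀ {q} → q ≤ m → f q ≡ c + q
    consecutive {zero}  _   = trans f₀≡c (sym (+-identityʳ c))
    consecutive {suc q} q<m = trans (step q<m) (trans (cong suc (consecutive (<⇒≤ q<m))) (sym (+-suc c q)))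

-- Staircases

staircase : ℕ → ℕ → List ℕ
staircase m k = k ∷ applyUpTo (λ q → suc q ⊓ k) m

module Staircase (m k : ℕ) where

  x = staircase m k

  length-x : length x ≡ suc m
  length-x = cong suc (length-applyUpTo _ m)

  x-at : ∀ {q} → q < m → at x (2 + q) ≡ suc q ⊓ k
  x-at = at-applyUpTo (λ q → suc q ⊓ k)

  rising : ∀ {q} → q < m → suc q ≤ k → at x (2 + q) ≡ suc q
  rising q<m q<k = trans (x-at q<m) (m≤n⇒m⊓n≡m q<k)

  flat : ∀ {q} → q < m → k ≤ suc q → at x (2 + q) ≡ k
  flat q<m k≤q = trans (x-at q<m) (m≥n⇒m⊓n≡n k≤q)

  monotone : ∀ {j l} → 2 ≤ j → j ≤ l → l ≤ suc m → at x j ≤ at x l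
  monotone (s≤s (s≤s _)) (s≤s (s≤s q≤r)) (s≤s r<m) =
    subst₂ _≤_ (sym (x-at (≤-<-trans q≤r r<m))) (sym (x-at r<m)) (⊓-monoˡ-≤ k (s≤s q≤r))

  avoids221 : ¬ Occurrence221 x
  avoids221 (occurrence {i} {j} {l} (1≤i , i<j , j<l , l≤n) xᵢ≡xⱼ xₗ<xᵢ) =
    <⇒≱ xₗ<xᵢ (subst (_≤ at x l) (sym xᵢ≡xⱼ) xⱼ≤xₗ)
    where xⱼ≤xₗ = monotone (≤-trans (s≤s 1≤i) i<j) (<⇒≤ j<l) (subst (l ≤_) length-x l≤n)

  max≤k : maxW x ≤ k
  max≤k = ⊔-lub ≤-refl (maxW-least _ (Allₚ.applyUpTo⁺₁ (λ q → suc q ⊓ k) m (λ _ → m⊓n≤n _ k)))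

  cayley : k ≤ m → ∀ {v} → 1 ≤ v → v ≤ maxW x → v ∈ x
  cayley k≤m {suc v} _ v≤max with m≤n⇒m<n∨m≡n (≤-trans v≤max max≤k)
  ... | inj₂ refl = here refl
  ... | inj₁ v<k  = there (subst (_∈ _) (m≤n⇒m⊓n≡m (<⇒≤ v<k)) (∈-applyUpTo⁺ (λ q → suc q ⊓ k) v<m))
    where v<m = <-≤-trans (≤-trans (n≤1+n _) v<k) k≤m

  ascentsAreNew : AscentsAreNew x
  ascentsAreNew {suc (suc q)} (s≤s (s≤s z≤n)) i<n with subst (2 + q <_) length-x i<n
  ... | s≤s q+1<m with suc q <? k
  ...   | yes q+1<k = mk⇔ (λ _ → fresh) (λ _ → ascent)
    where
    q<m = <-trans (n<1+n q) q+1<m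
    xᵢ≡q+1 = rising q<m (<⇒≤ q+1<k)
    ascent : at x (2 + q) < at x (3 + q)
    ascent = subst₂ _<_ (sym xᵢ≡q+1) (sym (rising q+1<m q+1<k)) (n<1+n _)
    fresh : ¬ Repeated x (2 + q)
    fresh (zero  , _ , k≡xᵢ) = <⇒≢ q+1<k (sym (trans k≡xᵢ xᵢ≡q+1))
    fresh (suc p , s≤s p<q , xₚ≡xᵢ) =
      <⇒≢ p<q (suc-injective (trans (sym (rising (<-trans p<q q<m) p+1≤k)) (trans xₚ≡xᵢ xᵢ≡q+1)))
      where p+1≤k = <⇒≤ (<-trans (s≤s p<q) q+1<k)
  ...   | no  q+1≮k = mk⇔ (λ asc → contradiction (subst₂ _<_ xᵢ≡k xᵢ₊₁≡k asc) (n≮n k))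
                          (λ new → contradiction repeated new)
    where
    q<m = <-trans (n<1+n q) q+1<m
    k≤q+1 = ≮⇒≥ q+1≮k
    xᵢ≡k = flat q<m k≤q+1
    xᵢ₊₁≡k = flat q+1<m (m≤n⇒m≤1+n k≤q+1)
    repeated : Repeated x (2 + q)
    repeated = 0 , s≤s z≤n , sym xᵢ≡k

staircase-RAS : ∀ {m k} → 1 ≤ m → k ≤ m → IsRAS (staircase m k)
staircase-RAS {suc m} {k} _ k≤m = record
  { cayley        = cayley k≤m
  ; ascentsAreNew = ascentsAreNew
  ; lastRepeated  = subst (Repeated x) (sym length-x) (0 , s≤s z≤n , sym (flat (n<1+n m) k≤m))
  }
  where open Staircase (suc m) k

staircase-entries : ∀ {m k} → 1 ≤ k → k ≤ m → All (_∈ range1 (suc m)) (staircase m k)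
staircase-entries {m} {k} 1≤k k≤m =
  from ∈-range1 (1≤k , m≤n⇒m≤1+n k≤m) ∷ Allₚ.applyUpTo⁺₁ _ m entry
  where
  entry : ∀ {q} → q < m → suc q ⊓ k ∈ range1 (suc m)
  entry _ = from ∈-range1 (⊓-glb (s≤s z≤n) 1≤k , m≤n⇒m≤1+n (≤-trans (m⊓n≤n _ k) k≤m))

-- Classification of the 221-avoiding revised ascent sequences

minimal : ∀ {P : ℕ → Set} → Decidable P → ∀ {b} → P b → ∃ λ j → j ≤ b × P j × (∀ {i} → i < j → ¬ P i)
minimal {P} P? {b} = <-rec Goal search b
  where
  Goal : ℕ → Set
  Goal b = P b → ∃ λ j → j ≤ b × P j × (∀ {i} → i < j → ¬ P i)
  search : ∀ b → (∀ {c} → c < b → Goal c) → Goal b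
  search b rec Pb with anyUpTo? P? b
  ... | no none = b , ≤-refl , Pb , λ i<b Pi → none (_ , i<b , Pi)
  ... | yes (c , c<b , Pc) with rec c<b Pc
  ...   | j , j≤c , Pj , none = j , ≤-trans j≤c (<⇒≤ c<b) , Pj , none

-- 2 + m is the first position repeating an earlier entry, and f q = x_{q+2}.
module FirstRepeat {k : ℕ} {y : List ℕ} (ras : IsRAS (k ∷ y)) (no221 : ¬ Occurrence221 (k ∷ y))
                   (positive : All (1 ≤_) y) (m : ℕ) (m<∣y∣ : m < length y)
                   (repeated : Repeated (k ∷ y) (2 + m))
                   (fresh : ∀ {i} → i < 2 + m → ¬ Repeated (k ∷ y) i) where

  open IsRAS ras

  f : ℕ → ℕ
  f q = at y (suc q)

  ascent : ∀ {q} → q < m → f q < f (suc q)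
  ascent q<m = from (ascentsAreNew (s≤s (s≤s z≤n)) (s≤s (≤-<-trans q<m m<∣y∣))) (fresh (s≤s (s≤s q<m)))

  open StrictlyIncreasing f m ascent

  fₘ≡k : f m ≡ k
  fₘ≡k = repeats-head repeated
    where
    repeats-head : Repeated (k ∷ y) (2 + m) → f m ≡ k
    repeats-head (zero  , _ , k≡fₘ)        = sym k≡fₘ
    repeats-head (suc p , s≤s p<m , fₚ≡fₘ) = contradiction fₚ≡fₘ (<⇒≢ (increasing p<m ≤-refl))

  plateau : ∀ {r} → m ≤′ r → r < length y → f r ≡ k
  plateau ≤′-refl _ = fₘ≡k
  plateau (≤′-step {r} m≤′r) r+1<∣y∣ =
    ≤-antisym (subst (f (suc r) ≤_) fᵣ≡k (≮⇒≥ no-ascent)) (≮⇒≥ no-descent)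
    where
    fᵣ≡k = plateau m≤′r (<-trans (n<1+n r) r+1<∣y∣)
    no-ascent : ¬ f r < f (suc r)
    no-ascent asc = to (ascentsAreNew (s≤s (s≤s z≤n)) (s≤s r+1<∣y∣)) asc (0 , s≤s z≤n , sym fᵣ≡k)
    no-descent : ¬ f (suc r) < k
    no-descent desc = no221 (occurrence (≤-refl , s≤s (s≤s z≤n) , n<1+n _ , s≤s r+1<∣y∣) (sym fᵣ≡k) desc)

  onto : ∀ {v} → 1 ≤ v → v < f m → ∃ λ p → p < m × f p ≡ v
  onto {v} 1≤v v<fₘ with cayley 1≤v (≤-trans (<⇒≤ v<k) (m≤m⊔n k _))
    where v<k = subst (v <_) fₘ≡k v<fₘ
  ... | here refl = contradiction fₘ≡k (<⇒≢ v<fₘ ∘ sym)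
  ... | there v∈y with ∈⇒at y v∈y
  ...   | r , r<∣y∣ , fᵣ≡v with r <? m
  ...     | yes r<m = r , r<m , fᵣ≡v
  ...     | no  r≮m = contradiction (trans (sym fᵣ≡v) (plateau (≤⇒≤′ (≮⇒≥ r≮m)) r<∣y∣))
                                      (<⇒≢ (subst (v <_) fₘ≡k v<fₘ))

  f≡suc : ∀ {q} → q ≤ m → f q ≡ suc q
  f≡suc = consecutive (All-at positive (≤-<-trans z≤n m<∣y∣)) onto

  k≡suc-m : k ≡ suc m
  k≡suc-m = trans (sym fₘ≡k) (f≡suc ≤-refl)

  y-shape : y ≡ applyUpTo (λ q → suc q ⊓ k) (length y)
  y-shape = applyUpTo-ext _ y entry
    where
    entry : ∀ {q} → q < length y → f q ≡ suc q ⊓ k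
    entry {q} q<∣y∣ with q ≤? m
    ... | yes q≤m = trans (f≡suc q≤m) (sym (m≤n⇒m⊓n≡m (subst (suc q ≤_) (sym k≡suc-m) (s≤s q≤m))))
    ... | no  q≰m = trans (plateau (≤⇒≤′ m≤q) q<∣y∣) (sym (m≥n⇒m⊓n≡n (subst (_≤ suc q) (sym k≡suc-m) (s≤s m≤q))))
      where m≤q = <⇒≤ (≰⇒> q≰m)

RAS-avoiding-221-is-staircase : ∀ {k y} → IsRAS (k ∷ y) → ¬ Occurrence221 (k ∷ y) → All (1 ≤_) y
                              → 1 ≤ k × k ≤ length y × k ∷ y ≡ staircase (length y) k
RAS-avoiding-221-is-staircase {k} {y} ras no221 positive
  with minimal (repeated? (k ∷ y)) {length (k ∷ y)} (IsRAS.lastRepeated ras)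
... | suc (suc m) , s≤s m<∣y∣ , repeated , fresh =
  subst (1 ≤_) (sym k≡suc-m) (s≤s z≤n) , subst (_≤ length y) (sym k≡suc-m) m<∣y∣ , cong (k ∷_) y-shape
  where open FirstRepeat ras no221 positive m m<∣y∣ repeated fresh

-- Counting

concatMap-map≡cartesianProductWith : ∀ {A B C : Set} (f : A → B → C) xs ys →
                                     concatMap (λ a → map (f a) ys) xs ≡ cartesianProductWith f xs ys
concatMap-map≡cartesianProductWith f []       ys = refl
concatMap-map≡cartesianProductWith f (x ∷ xs) ys =
  cong (map (f x) ys ++_) (concatMap-map≡cartesianProductWith f xs ys)

words-suc : ∀ k m → words (suc k) m ≡ cartesianProductWith _∷_ (range1 m) (words k m)
words-suc k m = concatMap-map≡cartesianProductWith _∷_ (range1 m) (words k m)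

unique-range1 : ∀ m → Unique (range1 m)
unique-range1 m = Uniqueₚ.applyUpTo⁺₁ suc m (λ i<j _ → <⇒≢ (s≤s i<j))

unique-words : ∀ k m → Unique (words k m)
unique-words zero    m = [] ∷ []
unique-words (suc k) m rewrite words-suc k m =
  Uniqueₚ.cartesianProductWith⁺ _∷_ ∷-injective (unique-range1 m) (unique-words k m)

∈-words⁻ : ∀ k m {w} → w ∈ words k m → length w ≡ k × All (_∈ range1 m) w
∈-words⁻ zero    m (here refl) = refl , []
∈-words⁻ (suc k) m w∈ rewrite words-suc k m with ∈-cartesianProductWith⁻ _∷_ (range1 m) (words k m) w∈
... | a , w , a∈ , w∈ , refl = let len , entries = ∈-words⁻ k m w∈ in cong suc len , a∈ ∷ entries

∈-words⁺ : ∀ m {w} → All (_∈ range1 m) w → w ∈ words (length w) m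
∈-words⁺ m []                     = here refl
∈-words⁺ m {a ∷ w} (a∈ ∷ entries) rewrite words-suc (length w) m =
  ∈-cartesianProductWith⁺ _∷_ a∈ (∈-words⁺ m entries)

is221AvoidingRAS : List ℕ → Bool
is221AvoidingRAS x = isRAS x ∧ avoids x σ221

T-is221AvoidingRAS : ∀ x → 2 ≤ length x → T (is221AvoidingRAS x) ⇔ (IsRAS x × ¬ Occurrence221 x)
T-is221AvoidingRAS x 2≤n = mk⇔
  (λ t → let ras , avoid = to T-∧ t in to (T-isRAS x 2≤n) ras , to T-not avoid ∘ from (T-contains221 x))
  (λ (ras , no221) → from T-∧ (from (T-isRAS x 2≤n) ras , from T-not (no221 ∘ to (T-contains221 x))))

∈-RASavoiding221 : ∀ {m} → 1 ≤ m → ∀ {x} → x ∈ RASavoiding (suc m) σ221 ⇔ x ∈ map (staircase m) (range1 m)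
∈-RASavoiding221 {m} 1≤m = mk⇔ staircase-shaped avoiding
  where
  staircase-shaped : ∀ {x} → x ∈ RASavoiding (suc m) σ221 → x ∈ map (staircase m) (range1 m)
  staircase-shaped {x} x∈ with ∈-filter⁻ (T? ∘ is221AvoidingRAS) x∈
  ... | x∈words , t with x | ∈-words⁻ (suc m) (suc m) x∈words
  ...   | k ∷ y | ∣x∣≡ , _ ∷ entries with to (T-is221AvoidingRAS (k ∷ y) (subst (2 ≤_) (sym ∣x∣≡) (s≤s 1≤m))) t
  ...     | ras , no221 = member (suc-injective ∣x∣≡) (RAS-avoiding-221-is-staircase ras no221 positive)
    where
    positive = All.map (proj₁ ∘ to ∈-range1) entries
    member : ∀ {n k y} → length y ≡ n → 1 ≤ k × k ≤ length y × k ∷ y ≡ staircase (length y) k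
           → k ∷ y ∈ map (staircase n) (range1 n)
    member {n} refl (1≤k , k≤n , eq) =
      subst (_∈ map (staircase n) (range1 n)) (sym eq) (∈-map⁺ (staircase n) (from ∈-range1 (1≤k , k≤n)))
  avoiding : ∀ {x} → x ∈ map (staircase m) (range1 m) → x ∈ RASavoiding (suc m) σ221
  avoiding x∈ with ∈-map⁻ (staircase m) x∈
  ... | k , k∈ , refl = ∈-filter⁺ (T? ∘ is221AvoidingRAS)
    (subst (λ n → x ∈ words n (suc m)) length-x (∈-words⁺ (suc m) (staircase-entries 1≤k k≤m)))
    (from (T-is221AvoidingRAS x (subst (2 ≤_) (sym length-x) (s≤s 1≤m))) (staircase-RAS 1≤m k≤m , avoids221))
    where
    open Staircase m k
    1≤k = proj₁ (to ∈-range1 k∈)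
    k≤m = proj₂ (to ∈-range1 k∈)

mainTheorem2 : (n : ℕ) → 2 ≤ n → length (RASavoiding n (2 ∷ 2 ∷ 1 ∷ [])) ≡ n ∸ 1
mainTheorem2 (suc m) (s≤s 1≤m) = begin
  length (RASavoiding (suc m) σ221)      ≡⟨ ↭-length avoiders↭staircases ⟩
  length (map (staircase m) (range1 m))  ≡⟨ length-map (staircase m) (range1 m) ⟩
  length (range1 m)                      ≡⟨ length-applyUpTo suc m ⟩
  m                                      ∎
  where
  open ≡-Reasoning
  avoiders-unique : Unique (RASavoiding (suc m) σ221)
  avoiders-unique = Uniqueₚ.filter⁺ (T? ∘ is221AvoidingRAS) (unique-words (suc m) (suc m))
  staircases-unique : Unique (map (staircase m) (range1 m))
  staircases-unique = Uniqueₚ.map⁺ (proj₁ ∘ ∷-injective) (unique-range1 m)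
  avoiders↭staircases : RASavoiding (suc m) σ221 ↭ map (staircase m) (range1 m)
  avoiders↭staircases = ∼bag⇒↭ (unique∧set⇒bag avoiders-unique staircases-unique (∈-RASavoiding221 1≤m))
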